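{- (i) If $r \ge 3$, $n_1,\dots,n_r$ are positive integers and $n=\sum_{i=1}^r n_i$, then ${\rm ex}(\mathcal{K}_{n_1,\dots , n_r}^{(r)}, F_r) = \mathcal{O}(n^{r-2})$. (ii) For every integer $r \ge 3$, ${\rm ex}(\mathcal{K}_{s,\dots , s}^{(r)}, F_r) = \Theta(s^{r-2})$ as $s\to\infty$.
   Context: $\mathcal{K}_{n_1,\dots,n_r}^{(r)}$ is the complete $r$-partite $r$-uniform hypergraph: vertex set $V_1\cup\cdots\cup V_r$ with pairwise disjoint parts, $|V_i|=n_i$, and edges all sets $e$ with $|e\cap V_i|=1$ for every $i$; $\mathcal{K}_{s,\dots,s}^{(r)}$ has all $r$ parts of size $s$. For $r\ge 2$, $F_r$ is the $r$-uniform hypergraph on $r+2$ vertices consisting of two edges $f_1,f_2$ with $|f_1\cap f_2| = r-2$. ${\rm ex}(\mathcal{K}_{n_1,\dots,n_r}^{(r)}, F_r)$ is the maximum number of edges of a subhypergraph of $\mathcal{K}_{n_1,\dots,n_r}^{(r)}$ containing no subhypergraph isomorphic to $F_r$. In (i) the implied constant depends only on $r$. -}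

module Defs where

open import Data.Nat using (ℕ; zero; suc; _<_; _∸_)
open import Data.Nat.Properties using (_≟_)
open import Data.Fin using (Fin)
open import Data.Vec using (Vec; []; _∷_; lookup; replicate)
open import Data.List using (List)
open import Data.List.Membership.Propositional using (_∈_)
open import Data.List.Relation.Unary.Unique.Propositional using (Unique)
open import Relation.Binary.PropositionalEquality using (_≡_; _≢_)
open import Relation.Nullary using (yes; no)
open import Data.Product using (_×_)

-- An edge of the complete r-partite r-uniform hypergraph K_{n_1,...,n_r}
-- is a choice of one vertex in each part: the vertex in part V_i is
-- encoded by its index (lookup e i) < n_i.  So the edge is the vertex set
-- { (i , lookup e i) | i : Fin r }.
IsEdge : ∀ {r} → Vec ℕ r → Vec ℕ r → Set
IsEdge {r} ns e = (i : Fin r) → lookup e i < lookup ns i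

-- Size of the intersection of the vertex sets of two edges: since the parts
-- are disjoint, it is the number of parts in which the two edges pick the
-- same vertex.
common : ∀ {r} → Vec ℕ r → Vec ℕ r → ℕ
common [] [] = zero
common (x ∷ xs) (y ∷ ys) with x ≟ y
... | yes _ = suc (common xs ys)
... | no  _ = common xs ys

-- A subhypergraph of K_{ns}: a duplicate-free list of edges of K_{ns};
-- its number of edges is the length of the list.
IsSubhypergraph : ∀ {r} → Vec ℕ r → List (Vec ℕ r) → Set
IsSubhypergraph ns H = Unique H × (∀ {e} → e ∈ H → IsEdge ns e)

-- H contains no copy of F_r: no two edges of H meet in exactly r-2 vertices.
FrFree : ∀ {r} → List (Vec ℕ r) → Set
FrFree {r} H = ∀ {e f} → e ∈ H → f ∈ H → common e f ≢ r ∸ 2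

{-# OPTIONS --safe #-}
-- Write r = k + 3 and call an edge f a neighbour of e in direction i ∈ {0,1,2}
-- if they differ exactly in coordinate i.  Neighbours of e in two different directions would
-- agree with each other in exactly r - 2 coordinates, so in an F_r-free H every edge has no
-- neighbours in some two directions i, j; on the edges of that class, forgetting coordinates
-- i and j is injective.  Hence |H| ≤ 3 N^(r-2) when all coordinates are below N.
-- Conversely the code edges (a, Σ z_i, Σ (i+1) z_i, z) with a < s and z ∈ [m]^k form an
-- F_r-free family: if z ≠ z' differ in one or two places the two checksums cannot both agree,
-- so such edges share at most r - 3 coordinates, while edges with z = z' share at least r - 1.
-- Taking m proportional to s gives s m^k ≥ c s^(r-2) edges.
module Submission where

open import Defs
open import Data.Nat using (ℕ; zero; suc; _+_; _*_; _^_; _∸_; _≤_; _<_; z≤n; s≤s; _/_; _%_; >-nonZero)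
open import Data.Nat.Properties
open import Function using (_∘_; _∘′_)
open import Algebra.Properties.CommutativeSemigroup +-commutativeSemigroup using (interchange)
open import Data.Nat.Tactic.RingSolver using (solve-∀)
open import Data.Nat.DivMod using (m≡m%n+[m/n]*n; m%n<n; m/n*n≤m; m≥n⇒m/n>0)
open import Data.Fin using (Fin; zero; suc)
open import Data.Vec using (Vec; []; _∷_; lookup; replicate; sum)
open import Data.Vec.Properties using (∷-injective; ≡-dec; lookup-replicate)
open import Data.Vec.Relation.Unary.All as All using (All; []; _∷_)
open import Data.Vec.Relation.Unary.All.Properties using (lookup⁺; lookup⁻)
open import Data.List using (List; []; _∷_; [_]; length; map; filter; cartesianProductWith; upTo)
open import Data.List.Properties using (length-map; length-++; length-upTo; length-removeAt′)
open import Data.List.Membership.Propositional using (_∈_; _─_; lose; find)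
open import Data.List.Membership.Propositional.Properties
  using (∈-cartesianProductWith⁺; ∈-cartesianProductWith⁻; ∈-upTo⁺; ∈-upTo⁻; ∈-filter⁻)
open import Data.List.Relation.Unary.Any using (Any; here; there; any?; index)
import Data.List.Relation.Unary.All as List
open import Data.List.Relation.Unary.AllPairs using ([]; _∷_)
open import Data.List.Relation.Unary.Unique.Propositional using (Unique)
open import Data.List.Relation.Unary.Unique.Propositional.Properties
  using (cartesianProductWith⁺; upTo⁺; filter⁺)
open import Data.Product using (_×_; _,_; ∃-syntax; proj₁; proj₂)
open import Data.Sum using (_⊎_; inj₁; inj₂)
open import Data.Empty using (⊥; ⊥-elim)
open import Relation.Nullary using (¬_; Dec; yes; no)
open import Relation.Nullary.Decidable using (_×-dec_; ¬?)
open import Relation.Unary using (Pred; Decidable)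
open import Relation.Binary.PropositionalEquality
  using (_≡_; _≢_; refl; sym; trans; cong; cong₂; subst; module ≡-Reasoning)

indicator : ∀ {p} {P : Set p} → Dec P → ℕ
indicator (yes _) = 1
indicator (no _)  = 0

indicator-yes : ∀ {p} {P : Set p} (d : Dec P) → P → indicator d ≡ 1
indicator-yes (yes _) _  = refl
indicator-yes (no ¬p) p = ⊥-elim (¬p p)

indicator-no : ∀ {p} {P : Set p} (d : Dec P) → ¬ P → indicator d ≡ 0
indicator-no (yes p) ¬p = ⊥-elim (¬p p)
indicator-no (no _)  _  = refl

indicator≤1 : ∀ {p} {P : Set p} (d : Dec P) → indicator d ≤ 1
indicator≤1 (yes _) = ≤-refl
indicator≤1 (no _)  = z≤n

indicator-≟-+ˡ : ∀ a m n → indicator (a + m ≟ a + n) ≡ indicator (m ≟ n)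
indicator-≟-+ˡ a m n with a + m ≟ a + n | m ≟ n
... | yes _   | yes _   = refl
... | no  _   | no  _   = refl
... | yes a+m≡a+n | no m≢n = ⊥-elim (m≢n (+-cancelˡ-≡ a m n a+m≡a+n))
... | no  a+m≢a+n | yes m≡n = ⊥-elim (a+m≢a+n (cong (a +_) m≡n))

indicator-pair≤1 : ∀ {a b c d} → ¬ (a ≡ b × c ≡ d) → indicator (a ≟ b) + indicator (c ≟ d) ≤ 1
indicator-pair≤1 {a} {b} {c} {d} ¬both with a ≟ b | c ≟ d
... | yes a≡b | yes c≡d = ⊥-elim (¬both (a≡b , c≡d))
... | yes _   | no _    = ≤-refl
... | no _    | yes _   = ≤-refl
... | no _    | no _    = z≤n

common-∷ : ∀ {n} x y (u v : Vec ℕ n) → common (x ∷ u) (y ∷ v) ≡ indicator (x ≟ y) + common u v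
common-∷ x y u v with x ≟ y
... | yes _ = refl
... | no _  = refl

common-refl : ∀ {n} (u : Vec ℕ n) → common u u ≡ n
common-refl []      = refl
common-refl (x ∷ u) rewrite common-∷ x x u u | indicator-yes (x ≟ x) refl = cong suc (common-refl u)

common≤length : ∀ {n} (u v : Vec ℕ n) → common u v ≤ n
common≤length []      []      = z≤n
common≤length (x ∷ u) (y ∷ v) with x ≟ y
... | yes _ = s≤s (common≤length u v)
... | no _  = m≤n⇒m≤1+n (common≤length u v)

common≡length⇒≡ : ∀ {n} (u v : Vec ℕ n) → common u v ≡ n → u ≡ v
common≡length⇒≡ []      []      _ = refl
common≡length⇒≡ (x ∷ u) (y ∷ v) eq with x ≟ y
... | yes refl = cong (x ∷_) (common≡length⇒≡ u v (suc-injective eq))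
... | no _     = ⊥-elim (<-irrefl eq (s≤s (common≤length u v)))

common<length : ∀ {n} (u v : Vec ℕ n) → u ≢ v → common u v < n
common<length u v u≢v = ≤∧≢⇒< (common≤length u v) (u≢v ∘′ common≡length⇒≡ u v)

∈-─ : ∀ {a} {A : Set a} {x z : A} {ys} (x∈ys : x ∈ ys) → z ∈ ys → z ≢ x → z ∈ ys ─ x∈ys
∈-─ (here refl)  (here refl)  z≢x = ⊥-elim (z≢x refl)
∈-─ (here refl)  (there z∈ys) _   = z∈ys
∈-─ (there x∈ys) (here refl)  _   = here refl
∈-─ (there x∈ys) (there z∈ys) z≢x = there (∈-─ x∈ys z∈ys z≢x)

injective⇒length≤ : ∀ {a b} {A : Set a} {B : Set b} (f : A → B) {xs : List A} {ys : List B} →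
  Unique xs → (∀ {x y} → x ∈ xs → y ∈ xs → f x ≡ f y → x ≡ y) → (∀ {x} → x ∈ xs → f x ∈ ys) →
  length xs ≤ length ys
injective⇒length≤ f {[]}     _             _   _    = z≤n
injective⇒length≤ f {x ∷ xs} {ys} (x∉xs ∷ xs!) inj into = begin
  suc (length xs)            ≤⟨ s≤s (injective⇒length≤ f xs! (λ p q → inj (there p) (there q)) into′) ⟩
  suc (length (ys ─ fx∈ys))  ≡⟨ length-removeAt′ ys (index fx∈ys) ⟨
  length ys                  ∎
  where
  open ≤-Reasoning
  fx∈ys = into (here refl)
  into′ : ∀ {z} → z ∈ xs → f z ∈ ys ─ fx∈ys
  into′ z∈xs = ∈-─ fx∈ys (into (there z∈xs))
    (λ fz≡fx → List.lookup x∉xs z∈xs (sym (inj (there z∈xs) (here refl) fz≡fx)))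

module _ {a p} {A : Set a} {P Q R : Pred A p} (P? : Decidable P) (Q? : Decidable Q) (R? : Decidable R) where

  private
    length-filter-∷ : ∀ {S : Pred A p} (S? : Decidable S) x xs →
      length (filter S? (x ∷ xs)) ≡ indicator (S? x) + length (filter S? xs)
    length-filter-∷ S? x xs with S? x
    ... | yes _ = refl
    ... | no _  = refl

    1≤indicator : ∀ {S : Set p} (d : Dec S) → S → 1 ≤ indicator d
    1≤indicator d s = ≤-reflexive (sym (indicator-yes d s))

  cover⇒length≤filters : ∀ xs → (∀ {x} → x ∈ xs → P x ⊎ Q x ⊎ R x) →
    length xs ≤ length (filter P? xs) + length (filter Q? xs) + length (filter R? xs)
  cover⇒length≤filters []       _     = z≤n
  cover⇒length≤filters (x ∷ xs) cover = begin
    1 + length xs                   ≤⟨ +-mono-≤ hit (cover⇒length≤filters xs (cover ∘ there)) ⟩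
    (iP + iQ + iR) + (lP + lQ + lR) ≡⟨ interchange (iP + iQ) iR (lP + lQ) lR ⟩
    (iP + iQ + (lP + lQ)) + (iR + lR) ≡⟨ cong (_+ (iR + lR)) (interchange iP iQ lP lQ) ⟩
    (iP + lP) + (iQ + lQ) + (iR + lR) ≡⟨ cong₂ _+_ (cong₂ _+_ (length-filter-∷ P? x xs) (length-filter-∷ Q? x xs))
                                                   (length-filter-∷ R? x xs) ⟨
    length (filter P? (x ∷ xs)) + length (filter Q? (x ∷ xs)) + length (filter R? (x ∷ xs)) ∎
    where
    open ≤-Reasoning
    iP = indicator (P? x)
    iQ = indicator (Q? x)
    iR = indicator (R? x)
    lP = length (filter P? xs)
    lQ = length (filter Q? xs)
    lR = length (filter R? xs)
    hit : 1 ≤ iP + iQ + iR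
    hit with cover (here refl)
    ... | inj₁ px        = ≤-trans (1≤indicator (P? x) px) (≤-trans (m≤m+n iP iQ) (m≤m+n (iP + iQ) iR))
    ... | inj₂ (inj₁ qx) = ≤-trans (1≤indicator (Q? x) qx) (≤-trans (m≤n+m iQ iP) (m≤m+n (iP + iQ) iR))
    ... | inj₂ (inj₂ rx) = ≤-trans (1≤indicator (R? x) rx) (m≤n+m iR (iP + iQ))

length-cartesianProductWith : ∀ {a b c} {A : Set a} {B : Set b} {C : Set c} (f : A → B → C) xs ys →
  length (cartesianProductWith f xs ys) ≡ length xs * length ys
length-cartesianProductWith f []       ys = refl
length-cartesianProductWith f (x ∷ xs) ys =
  trans (length-++ (map (f x) ys)) (cong₂ _+_ (length-map (f x) ys) (length-cartesianProductWith f xs ys))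

vectorsBelow : (m n : ℕ) → List (Vec ℕ m)
vectorsBelow zero    n = [ [] ]
vectorsBelow (suc m) n = cartesianProductWith _∷_ (upTo n) (vectorsBelow m n)

length-vectorsBelow : ∀ m n → length (vectorsBelow m n) ≡ n ^ m
length-vectorsBelow zero    n = refl
length-vectorsBelow (suc m) n = trans (length-cartesianProductWith _∷_ (upTo n) (vectorsBelow m n))
                                      (cong₂ _*_ (length-upTo n) (length-vectorsBelow m n))

∈-vectorsBelow⁺ : ∀ {m n} {v : Vec ℕ m} → All (_< n) v → v ∈ vectorsBelow m n
∈-vectorsBelow⁺ []         = here refl
∈-vectorsBelow⁺ (x<n ∷ v<n) = ∈-cartesianProductWith⁺ _∷_ (∈-upTo⁺ x<n) (∈-vectorsBelow⁺ v<n)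

∈-vectorsBelow⁻ : ∀ {m n} {v : Vec ℕ m} → v ∈ vectorsBelow m n → All (_< n) v
∈-vectorsBelow⁻ {zero}  {v = []} _ = []
∈-vectorsBelow⁻ {suc m} {n} v∈ with ∈-cartesianProductWith⁻ _∷_ (upTo n) (vectorsBelow m n) v∈
... | x , w , x∈ , w∈ , refl = ∈-upTo⁻ x∈ ∷ ∈-vectorsBelow⁻ w∈

vectorsBelow-unique : ∀ m n → Unique (vectorsBelow m n)
vectorsBelow-unique zero    n = List.[] ∷ []
vectorsBelow-unique (suc m) n = cartesianProductWith⁺ _∷_ ∷-injective (upTo⁺ n) (vectorsBelow-unique m n)

injective⇒length≤^ : ∀ {a} {A : Set a} {m n} (f : A → Vec ℕ m) {xs : List A} → Unique xs →
  (∀ {x y} → x ∈ xs → y ∈ xs → f x ≡ f y → x ≡ y) → (∀ {x} → x ∈ xs → All (_< n) (f x)) →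
  length xs ≤ n ^ m
injective⇒length≤^ {m = m} {n} f xs! inj bounded =
  ≤-trans (injective⇒length≤ f xs! inj (∈-vectorsBelow⁺ ∘′ bounded)) (≤-reflexive (length-vectorsBelow m n))

lookup≤sum : ∀ {r} (ns : Vec ℕ r) (i : Fin r) → lookup ns i ≤ sum ns
lookup≤sum (n ∷ ns) zero    = m≤m+n n (sum ns)
lookup≤sum (n ∷ ns) (suc i) = ≤-trans (lookup≤sum ns i) (m≤n+m (sum ns) n)

IsEdge⇒All<sum : ∀ {r} (ns : Vec ℕ r) {e} → IsEdge ns e → All (_< sum ns) e
IsEdge⇒All<sum ns e<ns = lookup⁻ (λ i → <-≤-trans (e<ns i) (lookup≤sum ns i))

IsEdge-replicate⇒All< : ∀ {r s} {e : Vec ℕ r} → IsEdge (replicate r s) e → All (_< s) e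
IsEdge-replicate⇒All< {s = s} e<s = lookup⁻ (λ i → subst (_ <_) (lookup-replicate i s) (e<s i))

All<⇒IsEdge-replicate : ∀ {r s} {e : Vec ℕ r} → All (_< s) e → IsEdge (replicate r s) e
All<⇒IsEdge-replicate {s = s} e<s i = subst (_ <_) (sym (lookup-replicate i s)) (lookup⁺ e<s i)

-- The upper bound

DiffersOnlyAt₀ DiffersOnlyAt₁ DiffersOnlyAt₂ : ∀ {k} → Vec ℕ (3 + k) → Vec ℕ (3 + k) → Set
DiffersOnlyAt₀ (x₀ ∷ x₁ ∷ x₂ ∷ t) (y₀ ∷ y₁ ∷ y₂ ∷ u) = x₀ ≢ y₀ × x₁ ≡ y₁ × x₂ ≡ y₂ × t ≡ u
DiffersOnlyAt₁ (x₀ ∷ x₁ ∷ x₂ ∷ t) (y₀ ∷ y₁ ∷ y₂ ∷ u) = x₀ ≡ y₀ × x₁ ≢ y₁ × x₂ ≡ y₂ × t ≡ u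
DiffersOnlyAt₂ (x₀ ∷ x₁ ∷ x₂ ∷ t) (y₀ ∷ y₁ ∷ y₂ ∷ u) = x₀ ≡ y₀ × x₁ ≡ y₁ × x₂ ≢ y₂ × t ≡ u

differsOnlyAt₀? : ∀ {k} (e f : Vec ℕ (3 + k)) → Dec (DiffersOnlyAt₀ e f)
differsOnlyAt₀? (x₀ ∷ x₁ ∷ x₂ ∷ t) (y₀ ∷ y₁ ∷ y₂ ∷ u) =
  ¬? (x₀ ≟ y₀) ×-dec x₁ ≟ y₁ ×-dec x₂ ≟ y₂ ×-dec ≡-dec _≟_ t u

differsOnlyAt₁? : ∀ {k} (e f : Vec ℕ (3 + k)) → Dec (DiffersOnlyAt₁ e f)
differsOnlyAt₁? (x₀ ∷ x₁ ∷ x₂ ∷ t) (y₀ ∷ y₁ ∷ y₂ ∷ u) =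
  x₀ ≟ y₀ ×-dec ¬? (x₁ ≟ y₁) ×-dec x₂ ≟ y₂ ×-dec ≡-dec _≟_ t u

differsOnlyAt₂? : ∀ {k} (e f : Vec ℕ (3 + k)) → Dec (DiffersOnlyAt₂ e f)
differsOnlyAt₂? (x₀ ∷ x₁ ∷ x₂ ∷ t) (y₀ ∷ y₁ ∷ y₂ ∷ u) =
  x₀ ≟ y₀ ×-dec x₁ ≟ y₁ ×-dec ¬? (x₂ ≟ y₂) ×-dec ≡-dec _≟_ t u

common-∷³ : ∀ {k} x₀ x₁ x₂ y₀ y₁ y₂ (t u : Vec ℕ k) →
  common (x₀ ∷ x₁ ∷ x₂ ∷ t) (y₀ ∷ y₁ ∷ y₂ ∷ u)
    ≡ indicator (x₀ ≟ y₀) + (indicator (x₁ ≟ y₁) + (indicator (x₂ ≟ y₂) + common t u))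
common-∷³ x₀ x₁ x₂ y₀ y₁ y₂ t u
  rewrite common-∷ x₀ y₀ (x₁ ∷ x₂ ∷ t) (y₁ ∷ y₂ ∷ u) | common-∷ x₁ y₁ (x₂ ∷ t) (y₂ ∷ u)
        | common-∷ x₂ y₂ t u = refl

common-agreeOnlyAt₀ : ∀ {k} x {x₁ x₂ y₁ y₂} (t : Vec ℕ k) → x₁ ≢ y₁ → x₂ ≢ y₂ →
  common (x ∷ x₁ ∷ x₂ ∷ t) (x ∷ y₁ ∷ y₂ ∷ t) ≡ suc k
common-agreeOnlyAt₀ x {x₁} {x₂} {y₁} {y₂} t x₁≢y₁ x₂≢y₂
  rewrite common-∷³ x x₁ x₂ x y₁ y₂ t t | indicator-yes (x ≟ x) refl
        | indicator-no (x₁ ≟ y₁) x₁≢y₁ | indicator-no (x₂ ≟ y₂) x₂≢y₂ | common-refl t = refl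

common-agreeOnlyAt₁ : ∀ {k} x {x₀ x₂ y₀ y₂} (t : Vec ℕ k) → x₀ ≢ y₀ → x₂ ≢ y₂ →
  common (x₀ ∷ x ∷ x₂ ∷ t) (y₀ ∷ x ∷ y₂ ∷ t) ≡ suc k
common-agreeOnlyAt₁ x {x₀} {x₂} {y₀} {y₂} t x₀≢y₀ x₂≢y₂
  rewrite common-∷³ x₀ x x₂ y₀ x y₂ t t | indicator-no (x₀ ≟ y₀) x₀≢y₀
        | indicator-yes (x ≟ x) refl | indicator-no (x₂ ≟ y₂) x₂≢y₂ | common-refl t = refl

common-agreeOnlyAt₂ : ∀ {k} x {x₀ x₁ y₀ y₁} (t : Vec ℕ k) → x₀ ≢ y₀ → x₁ ≢ y₁ →
  common (x₀ ∷ x₁ ∷ x ∷ t) (y₀ ∷ y₁ ∷ x ∷ t) ≡ suc k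
common-agreeOnlyAt₂ x {x₀} {x₁} {y₀} {y₁} t x₀≢y₀ x₁≢y₁
  rewrite common-∷³ x₀ x₁ x y₀ y₁ x t t | indicator-no (x₀ ≟ y₀) x₀≢y₀
        | indicator-no (x₁ ≟ y₁) x₁≢y₁ | indicator-yes (x ≟ x) refl | common-refl t = refl

common-differsOnlyAt₀₁ : ∀ {k} {e f g : Vec ℕ (3 + k)} →
  DiffersOnlyAt₀ e f → DiffersOnlyAt₁ e g → common f g ≡ suc k
common-differsOnlyAt₀₁ {e = _ ∷ _ ∷ x₂ ∷ t} {f = _ ∷ _ ∷ _ ∷ _} {g = _ ∷ _ ∷ _ ∷ _}
  (x₀≢y₀ , refl , refl , refl) (refl , x₁≢z₁ , refl , refl) =
  common-agreeOnlyAt₂ x₂ t (x₀≢y₀ ∘′ sym) x₁≢z₁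

common-differsOnlyAt₀₂ : ∀ {k} {e f g : Vec ℕ (3 + k)} →
  DiffersOnlyAt₀ e f → DiffersOnlyAt₂ e g → common f g ≡ suc k
common-differsOnlyAt₀₂ {e = _ ∷ x₁ ∷ _ ∷ t} {f = _ ∷ _ ∷ _ ∷ _} {g = _ ∷ _ ∷ _ ∷ _}
  (x₀≢y₀ , refl , refl , refl) (refl , refl , x₂≢z₂ , refl) =
  common-agreeOnlyAt₁ x₁ t (x₀≢y₀ ∘′ sym) x₂≢z₂

common-differsOnlyAt₁₂ : ∀ {k} {e f g : Vec ℕ (3 + k)} →
  DiffersOnlyAt₁ e f → DiffersOnlyAt₂ e g → common f g ≡ suc k
common-differsOnlyAt₁₂ {e = x₀ ∷ _ ∷ _ ∷ t} {f = _ ∷ _ ∷ _ ∷ _} {g = _ ∷ _ ∷ _ ∷ _}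
  (refl , x₁≢y₁ , refl , refl) (refl , refl , x₂≢z₂ , refl) =
  common-agreeOnlyAt₀ x₀ t (x₁≢y₁ ∘′ sym) x₂≢z₂

drop₁₂ drop₀₂ drop₀₁ : ∀ {k} → Vec ℕ (3 + k) → Vec ℕ (suc k)
drop₁₂ (x₀ ∷ _  ∷ _  ∷ t) = x₀ ∷ t
drop₀₂ (_  ∷ x₁ ∷ _  ∷ t) = x₁ ∷ t
drop₀₁ (_  ∷ _  ∷ x₂ ∷ t) = x₂ ∷ t

module _ {n k : ℕ} where
  All-drop₁₂ : {e : Vec ℕ (3 + k)} → All (_< n) e → All (_< n) (drop₁₂ e)
  All-drop₁₂ (x₀<n ∷ _ ∷ _ ∷ t<n) = x₀<n ∷ t<n

  All-drop₀₂ : {e : Vec ℕ (3 + k)} → All (_< n) e → All (_< n) (drop₀₂ e)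
  All-drop₀₂ (_ ∷ x₁<n ∷ _ ∷ t<n) = x₁<n ∷ t<n

  All-drop₀₁ : {e : Vec ℕ (3 + k)} → All (_< n) e → All (_< n) (drop₀₁ e)
  All-drop₀₁ (_ ∷ _ ∷ x₂<n ∷ t<n) = x₂<n ∷ t<n

module _ {k : ℕ} (H : List (Vec ℕ (3 + k))) (H-free : FrFree H) where

  Isolated₁₂ Isolated₀₂ Isolated₀₁ : Vec ℕ (3 + k) → Set
  Isolated₁₂ e = ¬ Any (DiffersOnlyAt₁ e) H × ¬ Any (DiffersOnlyAt₂ e) H
  Isolated₀₂ e = ¬ Any (DiffersOnlyAt₀ e) H × ¬ Any (DiffersOnlyAt₂ e) H
  Isolated₀₁ e = ¬ Any (DiffersOnlyAt₀ e) H × ¬ Any (DiffersOnlyAt₁ e) H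

  isolated₁₂? : Decidable Isolated₁₂
  isolated₁₂? e = ¬? (any? (differsOnlyAt₁? e) H) ×-dec ¬? (any? (differsOnlyAt₂? e) H)

  isolated₀₂? : Decidable Isolated₀₂
  isolated₀₂? e = ¬? (any? (differsOnlyAt₀? e) H) ×-dec ¬? (any? (differsOnlyAt₂? e) H)

  isolated₀₁? : Decidable Isolated₀₁
  isolated₀₁? e = ¬? (any? (differsOnlyAt₀? e) H) ×-dec ¬? (any? (differsOnlyAt₁? e) H)

  private
    neighbours-incompatible : ∀ {P Q : Vec ℕ (3 + k) → Vec ℕ (3 + k) → Set} {e} →
      (∀ {f g} → P e f → Q e g → common f g ≡ suc k) → Any (P e) H → Any (Q e) H → ⊥
    neighbours-incompatible common≡ Pe Qe with find Pe | find Qe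
    ... | _ , f∈H , p | _ , g∈H , q = H-free f∈H g∈H (common≡ p q)

  isolated : ∀ e → Isolated₁₂ e ⊎ Isolated₀₂ e ⊎ Isolated₀₁ e
  isolated e with any? (differsOnlyAt₀? e) H | any? (differsOnlyAt₁? e) H | any? (differsOnlyAt₂? e) H
  ... | _      | no ¬n₁ | no ¬n₂ = inj₁ (¬n₁ , ¬n₂)
  ... | no ¬n₀ | _      | no ¬n₂ = inj₂ (inj₁ (¬n₀ , ¬n₂))
  ... | no ¬n₀ | no ¬n₁ | _      = inj₂ (inj₂ (¬n₀ , ¬n₁))
  ... | yes n₀ | yes n₁ | _      =
    ⊥-elim (neighbours-incompatible {DiffersOnlyAt₀} {DiffersOnlyAt₁} common-differsOnlyAt₀₁ n₀ n₁)
  ... | yes n₀ | no _   | yes n₂ =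
    ⊥-elim (neighbours-incompatible {DiffersOnlyAt₀} {DiffersOnlyAt₂} common-differsOnlyAt₀₂ n₀ n₂)
  ... | no _   | yes n₁ | yes n₂ =
    ⊥-elim (neighbours-incompatible {DiffersOnlyAt₁} {DiffersOnlyAt₂} common-differsOnlyAt₁₂ n₁ n₂)

  drop₁₂-injective : ∀ {e f} → e ∈ H → f ∈ H → Isolated₁₂ e → drop₁₂ e ≡ drop₁₂ f → e ≡ f
  drop₁₂-injective {x₀ ∷ x₁ ∷ x₂ ∷ t} {_ ∷ y₁ ∷ y₂ ∷ _} e∈H f∈H (¬n₁ , ¬n₂) eq with ∷-injective eq
  ... | refl , refl with x₁ ≟ y₁ | x₂ ≟ y₂
  ... | yes refl  | yes refl  = refl
  ... | yes refl  | no x₂≢y₂  = ⊥-elim (¬n₂ (lose f∈H (refl , refl , x₂≢y₂ , refl)))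
  ... | no x₁≢y₁  | yes refl  = ⊥-elim (¬n₁ (lose f∈H (refl , x₁≢y₁ , refl , refl)))
  ... | no x₁≢y₁  | no x₂≢y₂  = ⊥-elim (H-free e∈H f∈H (common-agreeOnlyAt₀ x₀ t x₁≢y₁ x₂≢y₂))

  drop₀₂-injective : ∀ {e f} → e ∈ H → f ∈ H → Isolated₀₂ e → drop₀₂ e ≡ drop₀₂ f → e ≡ f
  drop₀₂-injective {x₀ ∷ x₁ ∷ x₂ ∷ t} {y₀ ∷ _ ∷ y₂ ∷ _} e∈H f∈H (¬n₀ , ¬n₂) eq with ∷-injective eq
  ... | refl , refl with x₀ ≟ y₀ | x₂ ≟ y₂
  ... | yes refl  | yes refl  = refl
  ... | yes refl  | no x₂≢y₂  = ⊥-elim (¬n₂ (lose f∈H (refl , refl , x₂≢y₂ , refl)))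
  ... | no x₀≢y₀  | yes refl  = ⊥-elim (¬n₀ (lose f∈H (x₀≢y₀ , refl , refl , refl)))
  ... | no x₀≢y₀  | no x₂≢y₂  = ⊥-elim (H-free e∈H f∈H (common-agreeOnlyAt₁ x₁ t x₀≢y₀ x₂≢y₂))

  drop₀₁-injective : ∀ {e f} → e ∈ H → f ∈ H → Isolated₀₁ e → drop₀₁ e ≡ drop₀₁ f → e ≡ f
  drop₀₁-injective {x₀ ∷ x₁ ∷ x₂ ∷ t} {y₀ ∷ y₁ ∷ _ ∷ _} e∈H f∈H (¬n₀ , ¬n₁) eq with ∷-injective eq
  ... | refl , refl with x₀ ≟ y₀ | x₁ ≟ y₁
  ... | yes refl  | yes refl  = refl
  ... | yes refl  | no x₁≢y₁  = ⊥-elim (¬n₁ (lose f∈H (refl , x₁≢y₁ , refl , refl)))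
  ... | no x₀≢y₀  | yes refl  = ⊥-elim (¬n₀ (lose f∈H (x₀≢y₀ , refl , refl , refl)))
  ... | no x₀≢y₀  | no x₁≢y₁  = ⊥-elim (H-free e∈H f∈H (common-agreeOnlyAt₂ x₂ t x₀≢y₀ x₁≢y₁))

  length≤3*^ : ∀ N → Unique H → (∀ {e} → e ∈ H → All (_< N) e) → length H ≤ 3 * N ^ suc k
  length≤3*^ N H! bounded = begin
    length H
      ≤⟨ cover⇒length≤filters isolated₁₂? isolated₀₂? isolated₀₁? H (λ {e} _ → isolated e) ⟩
    length (filter isolated₁₂? H) + length (filter isolated₀₂? H) + length (filter isolated₀₁? H)
      ≤⟨ +-mono-≤ (+-mono-≤ (class-≤ isolated₁₂? drop₁₂ drop₁₂-injective All-drop₁₂)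
                            (class-≤ isolated₀₂? drop₀₂ drop₀₂-injective All-drop₀₂))
                  (class-≤ isolated₀₁? drop₀₁ drop₀₁-injective All-drop₀₁) ⟩
    N ^ suc k + N ^ suc k + N ^ suc k
      ≡⟨ trans (+-assoc (N ^ suc k) _ _) (cong (λ y → N ^ suc k + (N ^ suc k + y)) (sym (+-identityʳ _))) ⟩
    3 * N ^ suc k ∎
    where
    open ≤-Reasoning
    class-≤ : ∀ {P : Vec ℕ (3 + k) → Set} (P? : Decidable P) (drop : Vec ℕ (3 + k) → Vec ℕ (suc k)) →
      (∀ {e f} → e ∈ H → f ∈ H → P e → drop e ≡ drop f → e ≡ f) →
      (∀ {e} → All (_< N) e → All (_< N) (drop e)) → length (filter P? H) ≤ N ^ suc k
    class-≤ {P} P? drop injective drop-< = injective⇒length≤^ drop (filter⁺ P? H!)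
      (λ e∈ f∈ → injective (proj₁ (filtered e∈)) (proj₁ (filtered f∈)) (proj₂ (filtered e∈)))
      (λ e∈ → drop-< (bounded (proj₁ (filtered e∈))))
      where
      filtered : ∀ {e} → e ∈ filter P? H → e ∈ H × P e
      filtered = ∈-filter⁻ P? {xs = H}

-- The lower bound

weightedSum : ∀ {j} → ℕ → Vec ℕ j → ℕ
weightedSum w []      = 0
weightedSum w (x ∷ z) = w * x + weightedSum (suc w) z

private
  regroup : ∀ a t x g s → a + g + t * (x + s) ≡ (a + t * x) + (g + t * s)
  regroup = solve-∀

  shift-∷ : ∀ a t x {g g′ s s′} → g + t * s′ ≡ g′ + t * s → a + g + t * (x + s′) ≡ a + g′ + t * (x + s)
  shift-∷ a t x {g} {g′} {s} {s′} shift =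
    trans (regroup a t x g s′) (trans (cong ((a + t * x) +_) shift) (sym (regroup a t x g′ s)))

  swap-heads : ∀ w x y g s → w * x + g + w * (y + s) ≡ w * y + g + w * (x + s)
  swap-heads = solve-∀

weightedSum-singleDifference : ∀ {j} w (u v : Vec ℕ j) → suc (common u v) ≡ j →
  ∃[ t ] (w ≤ t × weightedSum w u + t * sum v ≡ weightedSum w v + t * sum u)
weightedSum-singleDifference w (x ∷ u) (y ∷ v) eq rewrite common-∷ x y u v with x ≟ y
... | yes refl =
  let t , 1+w≤t , shift = weightedSum-singleDifference (suc w) u v (suc-injective eq)
  in t , ≤-trans (n≤1+n w) 1+w≤t , shift-∷ (w * x) t x shift
... | no _ with common≡length⇒≡ u v (suc-injective eq)
...   | refl = w , ≤-refl , swap-heads w x y (weightedSum (suc w) u) (sum u)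

private
  expand : ∀ c o x s → suc o * x + (c * x + (suc c + o) * s) ≡ (suc c + o) * (x + s)
  expand = solve-∀

  regroup-left : ∀ a b g g′ → a + b + (g + g′) ≡ (a + g) + (g′ + b)
  regroup-left = solve-∀

  regroup-right : ∀ a b g g′ → (a + g′) + (g + b) ≡ a + b + (g + g′)
  regroup-right = solve-∀

≡-from-two-weights : ∀ {c t} x y {s s′ g g′} → c < t →
  x + s ≡ y + s′ → c * x + g ≡ c * y + g′ → g + t * s′ ≡ g′ + t * s → x ≡ y
≡-from-two-weights {c} x y {s} {s′} {g} {g′} c<t sums weights shift
  with o , refl ← m≤n⇒∃[o]m+o≡n c<t = *-cancelˡ-≡ x y (suc o) (+-cancelʳ-≡ (c * y + t * s′) _ _ (begin
    suc o * x + (c * y + t * s′)  ≡⟨ cong (suc o * x +_) weights′ ⟨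
    suc o * x + (c * x + t * s)   ≡⟨ expand c o x s ⟩
    t * (x + s)                   ≡⟨ cong (t *_) sums ⟩
    t * (y + s′)                  ≡⟨ expand c o y s′ ⟨
    suc o * y + (c * y + t * s′)  ∎))
  where
  open ≡-Reasoning
  t = suc c + o
  weights′ : c * x + t * s ≡ c * y + t * s′
  weights′ = +-cancelʳ-≡ (g + g′) _ _ (begin
    c * x + t * s + (g + g′)    ≡⟨ regroup-left (c * x) (t * s) g g′ ⟩
    (c * x + g) + (g′ + t * s)  ≡⟨ cong₂ _+_ weights (sym shift) ⟩
    (c * y + g′) + (g + t * s′) ≡⟨ regroup-right (c * y) (t * s′) g g′ ⟩
    c * y + t * s′ + (g + g′)   ∎)

agreements : ∀ {j} → ℕ → Vec ℕ j → Vec ℕ j → ℕ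
agreements w u v =
  indicator (sum u ≟ sum v) + (indicator (weightedSum (suc w) u ≟ weightedSum (suc w) v) + common u v)

agreements-refl : ∀ {j} w (u : Vec ℕ j) → agreements w u u ≡ 2 + j
agreements-refl w u rewrite indicator-yes (sum u ≟ sum u) refl
  | indicator-yes (weightedSum (suc w) u ≟ weightedSum (suc w) u) refl | common-refl u = refl

agreements<length : ∀ {j} w (u v : Vec ℕ j) → u ≢ v → agreements w u v < j
agreements<length w []      []      []≢[] = ⊥-elim ([]≢[] refl)
agreements<length w (x ∷ u) (y ∷ v) xu≢yv rewrite common-∷ x y u v with x ≟ y
... | yes refl = begin-strict
  indicator (x + sum u ≟ x + sum v) + (indicator (suc w * x + G u ≟ suc w * x + G v) + suc (common u v))
    ≡⟨ cong₂ (λ p q → p + (q + suc (common u v))) (indicator-≟-+ˡ x _ _) (indicator-≟-+ˡ (suc w * x) _ _) ⟩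
  indicator (sum u ≟ sum v) + (indicator (G u ≟ G v) + suc (common u v))
    ≡⟨ trans (cong (indicator (sum u ≟ sum v) +_) (+-suc _ _)) (+-suc _ _) ⟩
  suc (agreements (suc w) u v)
    <⟨ s≤s (agreements<length (suc w) u v (xu≢yv ∘′ cong (x ∷_))) ⟩
  suc _ ∎
  where
  open ≤-Reasoning
  G : ∀ {j} → Vec ℕ j → ℕ
  G = weightedSum (suc (suc w))
... | no x≢y with ≡-dec _≟_ u v
...   | yes refl
  rewrite indicator-no (x + sum u ≟ y + sum u) (x≢y ∘′ +-cancelʳ-≡ (sum u) x y)
        | indicator-no (suc w * x + weightedSum (suc (suc w)) u ≟ suc w * y + weightedSum (suc (suc w)) u)
                       (x≢y ∘′ *-cancelˡ-≡ x y (suc w) ∘′ +-cancelʳ-≡ (weightedSum (suc (suc w)) u) _ _)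
        | common-refl u = ≤-refl
...   | no u≢v with m≤n⇒m<n∨m≡n (common<length u v u≢v)
...     | inj₁ 2+common≤j =
  s≤s (≤-trans (+-mono-≤ (indicator≤1 (x + sum u ≟ y + sum v))
                         (+-monoˡ-≤ (common u v) (indicator≤1 (suc w * x + weightedSum (suc (suc w)) u ≟
                                                               suc w * y + weightedSum (suc (suc w)) v))))
               2+common≤j)
...     | inj₂ 1+common≡j with weightedSum-singleDifference (suc (suc w)) u v 1+common≡j
...       | t , 2+w≤t , shift = s≤s (begin
  indicator sums? + (indicator weights? + common u v)
    ≡⟨ +-assoc (indicator sums?) (indicator weights?) (common u v) ⟨
  indicator sums? + indicator weights? + common u v
    ≤⟨ +-monoˡ-≤ (common u v) (indicator-pair≤1 λ (sums , weights) → x≢y (≡-from-two-weights x y 2+w≤t sums weights shift)) ⟩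
  suc (common u v)
    ≡⟨ 1+common≡j ⟩
  _ ∎)
  where
  open ≤-Reasoning
  sums?    = x + sum u ≟ y + sum v
  weights? = suc w * x + weightedSum (suc (suc w)) u ≟ suc w * y + weightedSum (suc (suc w)) v

codeEdge : ∀ {k} → ℕ → Vec ℕ k → Vec ℕ (3 + k)
codeEdge a z = a ∷ sum z ∷ weightedSum 1 z ∷ z

codeEdge-common≢ : ∀ {k} a b (z z′ : Vec ℕ k) → common (codeEdge a z) (codeEdge b z′) ≢ suc k
codeEdge-common≢ {k} a b z z′ eq with ≡-dec _≟_ z z′
... | yes refl = 1+n≰n (begin
  suc (suc k)                            ≡⟨ agreements-refl 0 z ⟨
  agreements 0 z z                       ≤⟨ m≤n+m _ (indicator (a ≟ b)) ⟩
  indicator (a ≟ b) + agreements 0 z z   ≡⟨ common-∷³ a _ _ b _ _ z z ⟨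
  common (codeEdge a z) (codeEdge b z)   ≡⟨ eq ⟩
  suc k                                  ∎)
  where open ≤-Reasoning
... | no z≢z′ = 1+n≰n (begin
  suc k                                    ≡⟨ eq ⟨
  common (codeEdge a z) (codeEdge b z′)    ≡⟨ common-∷³ a _ _ b _ _ z z′ ⟩
  indicator (a ≟ b) + agreements 0 z z′    ≤⟨ +-monoˡ-≤ _ (indicator≤1 (a ≟ b)) ⟩
  suc (agreements 0 z z′)                  ≤⟨ agreements<length 0 z z′ z≢z′ ⟩
  k                                        ∎)
  where open ≤-Reasoning

sum≤length*bound : ∀ {j m} {z : Vec ℕ j} → All (_< m) z → sum z ≤ j * m
sum≤length*bound []          = z≤n
sum≤length*bound (x<m ∷ z<m) = +-mono-≤ (<⇒≤ x<m) (sum≤length*bound z<m)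

sum≤weightedSum : ∀ {j} w (z : Vec ℕ j) → sum z ≤ weightedSum (suc w) z
sum≤weightedSum w []      = z≤n
sum≤weightedSum w (x ∷ z) = +-mono-≤ (m≤n*m x (suc w)) (sum≤weightedSum (suc w) z)

weightedSum≤ : ∀ {j} w (z : Vec ℕ j) → weightedSum w z ≤ (w + j) * sum z
weightedSum≤ w []              = z≤n
weightedSum≤ {suc j} w (x ∷ z) = begin
  w * x + weightedSum (suc w) z          ≤⟨ +-mono-≤ (*-monoˡ-≤ x (m≤m+n w (suc j))) (weightedSum≤ (suc w) z) ⟩
  (w + suc j) * x + (suc w + j) * sum z  ≡⟨ cong (λ n → (w + suc j) * x + n * sum z) (+-suc w j) ⟨
  (w + suc j) * x + (w + suc j) * sum z  ≡⟨ *-distribˡ-+ (w + suc j) x (sum z) ⟨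
  (w + suc j) * (x + sum z)              ∎
  where open ≤-Reasoning

codeEdge-bounded : ∀ {k s m a} {z : Vec ℕ k} → suc k * (k * m) < s → m ≤ s → a < s → All (_< m) z →
  All (_< s) (codeEdge a z)
codeEdge-bounded {k} {s} {z = z} check<s m≤s a<s z<m =
  a<s ∷ ≤-<-trans (sum≤weightedSum 0 z) weightedSum<s ∷ weightedSum<s ∷ All.map (λ x<m → <-≤-trans x<m m≤s) z<m
  where
  weightedSum<s : weightedSum 1 z < s
  weightedSum<s = ≤-<-trans (≤-trans (weightedSum≤ 1 z) (*-monoʳ-≤ (suc k) (sum≤length*bound z<m))) check<s

codeHypergraph : (k s m : ℕ) → List (Vec ℕ (3 + k))
codeHypergraph k s m = cartesianProductWith codeEdge (upTo s) (vectorsBelow k m)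

module _ (k s m : ℕ) where

  codeHypergraph-unique : Unique (codeHypergraph k s m)
  codeHypergraph-unique =
    cartesianProductWith⁺ codeEdge (λ { refl → refl , refl }) (upTo⁺ s) (vectorsBelow-unique k m)

  length-codeHypergraph : length (codeHypergraph k s m) ≡ s * m ^ k
  length-codeHypergraph = trans (length-cartesianProductWith codeEdge (upTo s) (vectorsBelow k m))
                                (cong₂ _*_ (length-upTo s) (length-vectorsBelow k m))

  codeHypergraph-free : FrFree (codeHypergraph k s m)
  codeHypergraph-free e∈ f∈
    with ∈-cartesianProductWith⁻ codeEdge (upTo s) (vectorsBelow k m) e∈
       | ∈-cartesianProductWith⁻ codeEdge (upTo s) (vectorsBelow k m) f∈
  ... | a , z , _ , _ , refl | b , z′ , _ , _ , refl = codeEdge-common≢ a b z z′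

  codeHypergraph-bounded : suc k * (k * m) < s → m ≤ s → ∀ {e} → e ∈ codeHypergraph k s m → All (_< s) e
  codeHypergraph-bounded check<s m≤s e∈
    with ∈-cartesianProductWith⁻ codeEdge (upTo s) (vectorsBelow k m) e∈
  ... | a , z , a∈ , z∈ , refl = codeEdge-bounded check<s m≤s (∈-upTo⁻ a∈) (∈-vectorsBelow⁻ z∈)

^-distrib-* : ∀ a b n → (a * b) ^ n ≡ a ^ n * b ^ n
^-distrib-* a b zero    = refl
^-distrib-* a b (suc n) = trans (cong (a * b *_) (^-distrib-* a b n)) (interchange* a b (a ^ n) (b ^ n))
  where
  interchange* : ∀ a b c d → a * b * (c * d) ≡ a * c * (b * d)
  interchange* = solve-∀

-- With m = s / checkScale k every checksum Σ (i+1) z_i ≤ (k+1) k m of a code edge stays below s.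
checkScale : ℕ → ℕ
checkScale k = suc (suc k * k)

module _ {k s : ℕ} (K≤s : checkScale k ≤ s) where

  private
    K = checkScale k
    m = s / K

    1≤m : 1 ≤ m
    1≤m = m≥n⇒m/n>0 K≤s

    K*m≤s : K * m ≤ s
    K*m≤s = ≤-trans (≤-reflexive (*-comm K m)) (m/n*n≤m s K)

    check<s : suc k * (k * m) < s
    check<s = begin-strict
      suc k * (k * m)      ≡⟨ *-assoc (suc k) k m ⟨
      suc k * k * m        <⟨ +-monoˡ-< (suc k * k * m) 1≤m ⟩
      m + suc k * k * m    ≤⟨ K*m≤s ⟩
      s                    ∎
      where open ≤-Reasoning

    m≤s : m ≤ s
    m≤s = ≤-trans (m≤m+n m (suc k * k * m)) K*m≤s

    s≤2K*m : s ≤ 2 * K * m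
    s≤2K*m = begin
      s                ≡⟨ m≡m%n+[m/n]*n s K ⟩
      s % K + m * K    ≤⟨ +-monoˡ-≤ (m * K) (≤-trans (<⇒≤ (m%n<n s K)) (m≤m*n K m {{>-nonZero 1≤m}})) ⟩
      K * m + m * K    ≡⟨ double K m ⟩
      2 * K * m        ∎
      where
      open ≤-Reasoning
      double : ∀ a b → a * b + b * a ≡ 2 * a * b
      double = solve-∀

  largeFreeSubhypergraph : ∃[ H ] (IsSubhypergraph (replicate (3 + k) s) H × FrFree H ×
                                 s ^ suc k ≤ (2 * K) ^ k * length H)
  largeFreeSubhypergraph =
    codeHypergraph k s m ,
    (codeHypergraph-unique k s m , All<⇒IsEdge-replicate ∘′ codeHypergraph-bounded k s m check<s m≤s) ,
    codeHypergraph-free k s m ,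
    (begin
      s * s ^ k                      ≤⟨ *-monoʳ-≤ s (^-monoˡ-≤ k s≤2K*m) ⟩
      s * (2 * K * m) ^ k            ≡⟨ cong (s *_) (^-distrib-* (2 * K) m k) ⟩
      s * ((2 * K) ^ k * m ^ k)      ≡⟨ *-comm-middle s ((2 * K) ^ k) (m ^ k) ⟩
      (2 * K) ^ k * (s * m ^ k)      ≡⟨ cong ((2 * K) ^ k *_) (length-codeHypergraph k s m) ⟨
      (2 * K) ^ k * length (codeHypergraph k s m) ∎)
    where
    open ≤-Reasoning
    *-comm-middle : ∀ a b c → a * (b * c) ≡ b * (a * c)
    *-comm-middle = solve-∀

proposition6p2 : (r : ℕ) → 3 ≤ r →
    (∃[ C ] ((ns : Vec ℕ r) → All (0 <_) ns → (H : List (Vec ℕ r)) →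
        IsSubhypergraph ns H → FrFree H → length H ≤ C * sum ns ^ (r ∸ 2)))
    × ((∃[ C ] ∃[ s₀ ] ((s : ℕ) → s₀ ≤ s → (H : List (Vec ℕ r)) →
          IsSubhypergraph (replicate r s) H → FrFree H → length H ≤ C * s ^ (r ∸ 2)))
       × (∃[ d ] ∃[ s₀ ] ((s : ℕ) → s₀ ≤ s → ∃[ H ]
          (IsSubhypergraph (replicate r s) H × FrFree H × s ^ (r ∸ 2) ≤ d * length H))))
proposition6p2 (suc (suc (suc k))) (s≤s (s≤s (s≤s _))) =
  (3 , λ ns _ H (H! , edges) H-free →
         length≤3*^ H H-free (sum ns) H! (λ e∈H → IsEdge⇒All<sum ns (edges e∈H))) ,
  ((3 , 0 , λ s _ H (H! , edges) H-free →
         length≤3*^ H H-free s H! (λ e∈H → IsEdge-replicate⇒All< (edges e∈H))) ,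
   ((2 * checkScale k) ^ k , checkScale k , λ s → largeFreeSubhypergraph))
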